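{- Let $\Gamma=(V,E)$ be a graph and $\mathsf H=\mathrm{Inc}(\Gamma)$. Let $V'\subset V$ and $E'\subset E$ have the same cardinality, and suppose that $\mathsf H'=\mathsf H[V'\mid E']$ is connected and nondegenerate. Then precisely one of the following holds: (U1) $(V',E')$ is a unicyclic loopless subgraph of $\Gamma$ and $\mathsf H'$ is its incidence hypergraph; (U2) $\mathsf H'$ contains a unique loop $e_\circ$ and $(V',E'\setminus\{e_\circ\})$ is a subtree of $\Gamma$.
   Context: A graph $\Gamma=(V,E)$ has finite vertex set $V$ and a set $E$ of edges, each a subset of $V$ of size $1$ (a loop) or $2$. A hypergraph is $(V,E,\imath)$ with $\imath\subset V\times E$; the support of $e$ is $\|e\|=\{v: v\,\imath\,e\}$. $\mathrm{Inc}(\Gamma)=(V,E,\imath)$ with $v\,\imath\,e$ iff $v\in e$. For $V'\subset V$, $E'\subset E$, the induced subhypergraph is $\mathsf H[V'\mid E']=(V',E',\imath\cap(V'\times E'))$. A hyperedge $e$ is a loop of a hypergraph if $|\|e\||=1$, empty if $\|e\|=\emptyset$; a vertex is isolated if incident with no hyperedge; a hypergraph is nondegenerate if it has no isolated vertices and no empty hyperedges. Two vertices are connected if there is a walk $u_1,e_1,u_2,\dots,e_r,u_{r+1}$ with $u_i,u_{i+1}\,\imath\,e_i$ for all $i$; a hypergraph is connected if it has at least one vertex, no empty hyperedges, and all vertices are pairwise connected. A graph is unicyclic if it is connected and contains a unique cycle (equivalently, connected with as many edges as vertices). -}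

module Defs where

open import Data.Nat using (ℕ; zero; suc; _+_)
open import Data.Fin using (Fin)
open import Data.Fin.Properties using (_≟_)
open import Data.Fin.Subset using (Subset; _∈_; _∉_; ∣_∣)
open import Data.Fin.Subset.Properties using (_∈?_)
open import Data.List using (List; map; allFin)
open import Data.Nat.ListAction using (sum)
open import Data.Product using (Σ; ∃; _×_; _,_; proj₁; proj₂; Σ-syntax; ∃-syntax)
open import Data.Sum using (_⊎_)
open import Data.Bool using (if_then_else_)
open import Relation.Nullary using (¬_; does)
open import Relation.Binary.PropositionalEquality using (_≡_; _≢_)

-- Each edge e is a subset of V of size
-- 1 or 2, given by an unordered pair of endpoints  ends e = (u , w)
-- (the edge {u,w}; a loop {u} when u ≡ w).  Since E is a *set* of
-- subsets of V, distinct edges have distinct vertex sets.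

record Graph : Set where
  field
    n    : ℕ
    m    : ℕ
    ends : Fin m → Fin n × Fin n

  _∈ₑ_ : Fin n → Fin m → Set
  v ∈ₑ e = (v ≡ proj₁ (ends e)) ⊎ (v ≡ proj₂ (ends e))

  field
    edges-distinct : ∀ e f → (∀ v → (v ∈ₑ e → v ∈ₑ f) × (v ∈ₑ f → v ∈ₑ e)) → e ≡ f

record Hypergraph : Set₁ where
  field
    Vtx : Set
    Edg : Set
    inc : Vtx → Edg → Set

module _ (H : Hypergraph) where
  open Hypergraph H

  IsLoop : Edg → Set
  IsLoop e = Σ[ v ∈ Vtx ] (inc v e × (∀ w → inc w e → w ≡ v))

  IsEmptyEdge : Edg → Set
  IsEmptyEdge e = ∀ v → ¬ inc v e

  Isolated : Vtx → Set
  Isolated v = ∀ e → ¬ inc v e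

  Nondegenerate : Set
  Nondegenerate = (∀ v → ¬ Isolated v) × (∀ e → ¬ IsEmptyEdge e)

  data HWalk : Vtx → Vtx → Set where
    here : ∀ {u} → HWalk u u
    step : ∀ {u w v} (e : Edg) → inc u e → inc w e → HWalk w v → HWalk u v

  HConnected : Set
  HConnected = Vtx × (∀ e → ¬ IsEmptyEdge e) × (∀ u v → HWalk u v)

Inc : Graph → Hypergraph
Inc Γ = record { Vtx = Fin n ; Edg = Fin m ; inc = _∈ₑ_ }
  where open Graph Γ

module _ (Γ : Graph) where
  open Graph Γ

  Induced : Subset n → Subset m → Hypergraph
  Induced V' E' = record
    { Vtx = Σ (Fin n) (_∈ V')
    ; Edg = Σ (Fin m) (_∈ E')
    ; inc = λ v e → Hypergraph.inc (Inc Γ) (proj₁ v) (proj₁ e) }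

  data EWalk (F : Fin m → Set) : Fin n → Fin n → Set where
    here : ∀ {u} → EWalk F u u
    step : ∀ {u w v} (e : Fin m) → F e → u ∈ₑ e → w ∈ₑ e → EWalk F w v → EWalk F u v

  IsSubgraph : Subset n → (Fin m → Set) → Set
  IsSubgraph V' F = ∀ e → F e → ∀ v → v ∈ₑ e → v ∈ V'

  Loopless : (Fin m → Set) → Set
  Loopless F = ∀ e → F e → proj₁ (ends e) ≢ proj₂ (ends e)

  GConnected : Subset n → (Fin m → Set) → Set
  GConnected V' F = (∃[ v ] v ∈ V') × (∀ u v → u ∈ V' → v ∈ V' → EWalk F u v)

  -- multiplicity of v in e (a loop counts twice), and degree in an edge set C
  mult : Fin n → Fin m → ℕ
  mult v e = (if does (v ≟ proj₁ (ends e)) then 1 else 0)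
           + (if does (v ≟ proj₂ (ends e)) then 1 else 0)

  deg : Subset m → Fin n → ℕ
  deg C v = sum (map (λ e → if does (e ∈? C) then mult v e else 0) (allFin m))

  VtxOf : Subset m → Fin n → Set
  VtxOf C v = ∃[ e ] (e ∈ C × v ∈ₑ e)

  -- a cycle of (V', F): a nonempty edge set C ⊆ F spanning a connected
  -- 2-regular subgraph (a loop contributes 2 to the degree)
  IsCycle : (Fin m → Set) → Subset m → Set
  IsCycle F C = (∀ e → e ∈ C → F e)
              × (∃[ e ] e ∈ C)
              × (∀ v → VtxOf C v → deg C v ≡ 2)
              × (∀ u v → VtxOf C u → VtxOf C v → EWalk (_∈ C) u v)

  Unicyclic : Subset n → (Fin m → Set) → Set
  Unicyclic V' F = GConnected V' F
                 × Σ[ C ∈ Subset m ] (IsCycle F C × (∀ C' → IsCycle F C' → C' ≡ C))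

  IsTree : Subset n → (Fin m → Set) → Set
  IsTree V' F = GConnected V' F × (∀ C → ¬ IsCycle F C)

  -- (U1): (V',E') is a unicyclic loopless subgraph of Γ
  -- (then H[V'|E'] is automatically its incidence hypergraph)
  U1 : Subset n → Subset m → Set
  U1 V' E' = IsSubgraph V' (_∈ E') × Loopless (_∈ E') × Unicyclic V' (_∈ E')

  U2 : Subset n → Subset m → Set
  U2 V' E' =
    Σ[ e∘ ∈ Hypergraph.Edg (Induced V' E') ]
      ( IsLoop (Induced V' E') e∘
      × (∀ e → IsLoop (Induced V' E') e → proj₁ e ≡ proj₁ e∘)
      × IsSubgraph V' (λ e → e ∈ E' × e ≢ proj₁ e∘)
      × IsTree V' (λ e → e ∈ E' × e ≢ proj₁ e∘))

ExactlyOne : Set → Set → Set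
ExactlyOne A B = (A × ¬ B) ⊎ (B × ¬ A)

-- Let P ⊆ E' be the edges joining two distinct vertices of V'.  Every other edge of E' meets V' in
-- at most one vertex, hence in exactly one since H' has no empty edges: these are the loops of H'.
-- Walks of H' are walks of the graph (V', P), so (V', P) is connected and |V'| ≤ |P| + 1; as
-- |E'| = |V'|, at most one edge of E' lies outside P.  If none does, (V', E') is a connected loopless
-- graph with as many edges as vertices, hence unicyclic; if e∘ does, it is the unique loop of H' and
-- (V', E' ∖ {e∘}) is connected with one edge fewer than vertices, hence a tree.  Both counting facts
-- follow by repeatedly deleting a vertex of degree one, which exists by the handshake lemma unless
-- all degrees are at least two, and a connected graph all of whose degrees are two is its own unique
-- cycle.

module Submission where

open import Defs

open import Data.Bool using (true; false; if_then_else_)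
open import Data.Fin using (Fin; zero; suc)
open import Data.Fin.Properties using (any?; _≟_)
open import Data.Fin.Subset using (Subset; _∈_; _∉_; _⊆_; _-_; _─_; ∣_∣; inside; outside; Nonempty)
open import Data.Fin.Subset.Properties
  using (_∈?_; ⊆-antisym; p⊆q⇒∣p∣≤∣q∣; p─⊥≡p; p─q⊆p; x∉⁅y⁆⇒x≢y; x∈p∧x≢y⇒x∈p-y)
open import Data.List using (allFin)
import Data.List as List
import Data.List.Properties as List
open import Data.Nat using (ℕ; zero; suc; _+_; _*_; _≤_; _<_; z≤n; s≤s; s≤s⁻¹; _<?_; _≤?_)
  renaming (_≟_ to _≟ℕ_)
open import Data.Nat.ListAction using () renaming (sum to sumᴸ)
open import Data.Nat.Properties
  using ( ≤-refl; ≤-trans; ≤-antisym; <-irrefl; <⇒≱; ≮⇒≥; ≰⇒>; ≤∧≢⇒<; n≤1+n; n<1+n; m≤m+n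
        ; suc-injective; +-suc; +-mono-≤; +-mono-<-≤; *-zeroˡ; *-zeroʳ; *-identityˡ; *-suc; *-cancelˡ-≤
        ; +-0-commutativeMonoid; +-commutativeSemigroup; module ≤-Reasoning )
open import Data.Product using (Σ-syntax; ∃; _×_; _,_; proj₁; proj₂)
open import Data.Sum using (_⊎_; inj₁; inj₂)
open import Data.Vec using (_∷_; []; tabulate)
open import Data.Vec.Base using (here; there)
open import Data.Vec.Properties using (lookup∘tabulate; lookup⇒[]=; []=⇒lookup)
open import Data.Vec.Properties.WithK using ([]=-irrelevant)
open import Function using (_∘_; id)
open import Relation.Binary.PropositionalEquality
open import Relation.Nullary using (¬_; ¬?; does; yes; no; contradiction; _×-dec_)
open import Relation.Nullary.Decidable using (dec-true; dec-false; decidable-stable)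
open import Relation.Unary using (Decidable)

open import Algebra.Properties.CommutativeMonoid.Sum +-0-commutativeMonoid
  using (sum-syntax; ∑-distrib-+; ∑-comm; sum-replicate-zero; sum-cong-≗)
open import Algebra.Properties.CommutativeSemigroup +-commutativeSemigroup using (x∙yz≈y∙xz)

sumOver : ∀ {k} → Subset k → (Fin k → ℕ) → ℕ
sumOver {k} p f = ∑[ i < k ] (if does (i ∈? p) then f i else 0)

syntax sumOver p (λ i → x) = ∑[ i ∈ p ] x

∑-mono-≤ : ∀ {k} {f g : Fin k → ℕ} → (∀ i → f i ≤ g i) → ∑[ i < k ] f i ≤ ∑[ i < k ] g i
∑-mono-≤ {zero}  _   = z≤n
∑-mono-≤ {suc k} f≤g = +-mono-≤ (f≤g zero) (∑-mono-≤ (f≤g ∘ suc))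

sumOver-const : ∀ {k} (p : Subset k) c → ∑[ _ ∈ p ] c ≡ c * ∣ p ∣
sumOver-const []            c = sym (*-zeroʳ c)
sumOver-const (inside  ∷ p) c = trans (cong (c +_) (sumOver-const p c)) (sym (*-suc c ∣ p ∣))
sumOver-const (outside ∷ p) c = sumOver-const p c

sumOver-remove : ∀ {k} {p : Subset k} {x} (f : Fin k → ℕ) → x ∈ p →
                 ∑[ i ∈ p ] f i ≡ f x + ∑[ i ∈ p - x ] f i
sumOver-remove {p = inside ∷ p} f here = cong (λ q → f zero + ∑[ i ∈ q ] f (suc i)) (sym (p─⊥≡p p))
sumOver-remove {p = s ∷ p} {suc x} f (there x∈p) = by-head s
  where
  rest = sumOver-remove (f ∘ suc) x∈p
  -- the head summands of s ∷ p and of (s ∷ p) - suc x only reduce once s is known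
  by-head : ∀ s → ∑[ i ∈ s ∷ p ] f i ≡ f (suc x) + ∑[ i ∈ (s ∷ p) - suc x ] f i
  by-head inside  = trans (cong (f zero +_) rest) (x∙yz≈y∙xz (f zero) (f (suc x)) _)
  by-head outside = rest

sumOver-mono-⊆ : ∀ {k} {p q : Subset k} (f : Fin k → ℕ) → p ⊆ q → ∑[ i ∈ p ] f i ≤ ∑[ i ∈ q ] f i
sumOver-mono-⊆ {p = p} {q} f p⊆q = ∑-mono-≤ pointwise
  where
  pointwise : ∀ i → (if does (i ∈? p) then f i else 0) ≤ (if does (i ∈? q) then f i else 0)
  pointwise i with i ∈? p | i ∈? q
  ... | yes _   | yes _   = ≤-refl
  ... | yes i∈p | no  i∉q = contradiction (p⊆q i∈p) i∉q
  ... | no  _   | _       = z≤n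

sumOver-monoʳ-≤ : ∀ {k} (p : Subset k) {f g : Fin k → ℕ} → (∀ {i} → i ∈ p → f i ≤ g i) →
                  ∑[ i ∈ p ] f i ≤ ∑[ i ∈ p ] g i
sumOver-monoʳ-≤ p {f} {g} f≤g = ∑-mono-≤ pointwise
  where
  pointwise : ∀ i → (if does (i ∈? p) then f i else 0) ≤ (if does (i ∈? p) then g i else 0)
  pointwise i with i ∈? p
  ... | yes i∈p = f≤g i∈p
  ... | no  _   = z≤n

sumOver-monoʳ-< : ∀ {k} (p : Subset k) {f g : Fin k → ℕ} → (∀ {i} → i ∈ p → f i ≤ g i) →
                  ∀ {x} → x ∈ p → f x < g x → ∑[ i ∈ p ] f i < ∑[ i ∈ p ] g i
sumOver-monoʳ-< p {f} {g} f≤g x∈p fx<gx =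
  subst₂ _<_ (sym (sumOver-remove f x∈p)) (sym (sumOver-remove g x∈p))
    (+-mono-<-≤ fx<gx (sumOver-monoʳ-≤ (p - _) (f≤g ∘ p─q⊆p p _)))

sumOver-≤-∑ : ∀ {k} (p : Subset k) (f : Fin k → ℕ) → ∑[ i ∈ p ] f i ≤ ∑[ i < k ] f i
sumOver-≤-∑ p f = ∑-mono-≤ pointwise
  where
  pointwise : ∀ i → (if does (i ∈? p) then f i else 0) ≤ f i
  pointwise i with does (i ∈? p)
  ... | true  = ≤-refl
  ... | false = z≤n

sumOver-pos : ∀ {k} (p : Subset k) (f : Fin k → ℕ) → 0 < ∑[ i ∈ p ] f i → ∃ λ i → i ∈ p × 0 < f i
sumOver-pos p f 0<∑ with any? (λ i → i ∈? p ×-dec 0 <? f i)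
... | yes witness = witness
... | no  none    = contradiction ∑≤0 (<⇒≱ 0<∑)
  where
  ∑≤0 : ∑[ i ∈ p ] f i ≤ 0
  ∑≤0 = subst (∑[ i ∈ p ] f i ≤_) (trans (sumOver-const p 0) (*-zeroˡ ∣ p ∣))
          (sumOver-monoʳ-≤ p (λ {i} i∈p → ≮⇒≥ (λ 0<fi → none (i , i∈p , 0<fi))))

∣p∣≡∑1 : ∀ {k} (p : Subset k) → ∣ p ∣ ≡ ∑[ _ ∈ p ] 1
∣p∣≡∑1 p = sym (trans (sumOver-const p 1) (*-identityˡ ∣ p ∣))

x∈p⇒∣p∣≡1+∣p-x∣ : ∀ {k} {p : Subset k} {x} → x ∈ p → ∣ p ∣ ≡ suc ∣ p - x ∣
x∈p⇒∣p∣≡1+∣p-x∣ {p = p} {x} x∈p = begin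
  ∣ p ∣                      ≡⟨ ∣p∣≡∑1 p ⟩
  ∑[ _ ∈ p ] 1               ≡⟨ sumOver-remove (λ _ → 1) x∈p ⟩
  suc (∑[ _ ∈ p - x ] 1)     ≡⟨ cong suc (∣p∣≡∑1 (p - x)) ⟨
  suc ∣ p - x ∣              ∎
  where open ≡-Reasoning

x∈p⇒0<∣p∣ : ∀ {k} {p : Subset k} {x} → x ∈ p → 0 < ∣ p ∣
x∈p⇒0<∣p∣ x∈p = subst (0 <_) (sym (x∈p⇒∣p∣≡1+∣p-x∣ x∈p)) (s≤s z≤n)

x,y∈p⇒2≤∣p∣ : ∀ {k} {p : Subset k} {x y} → x ∈ p → y ∈ p → x ≢ y → 2 ≤ ∣ p ∣
x,y∈p⇒2≤∣p∣ x∈p y∈p x≢y =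
  subst (2 ≤_) (sym (x∈p⇒∣p∣≡1+∣p-x∣ x∈p)) (s≤s (x∈p⇒0<∣p∣ (x∈p∧x≢y⇒x∈p-y y∈p (x≢y ∘ sym))))

0<∣p∣⇒Nonempty : ∀ {k} (p : Subset k) → 0 < ∣ p ∣ → Nonempty p
0<∣p∣⇒Nonempty p 0<∣p∣ with sumOver-pos p (λ _ → 1) (subst (0 <_) (∣p∣≡∑1 p) 0<∣p∣)
... | i , i∈p , _ = i , i∈p

x∈p─q⇒x∉q : ∀ {k} {p q : Subset k} {x} → x ∈ p ─ q → x ∉ q
x∈p─q⇒x∉q {p = _ ∷ _} {_ ∷ _} (there x∈p─q) (there x∈q) = x∈p─q⇒x∉q x∈p─q x∈q

x∈p-y⇒x≢y : ∀ {k} {p : Subset k} {x y} → x ∈ p - y → x ≢ y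
x∈p-y⇒x≢y x∈p-y = x∉⁅y⁆⇒x≢y (x∈p─q⇒x∉q x∈p-y)

subsetOf : ∀ {k} {P : Fin k → Set} → Decidable P → Subset k
subsetOf P? = tabulate (does ∘ P?)

∈-subsetOf⁺ : ∀ {k} {P : Fin k → Set} (P? : Decidable P) {x} → P x → x ∈ subsetOf P?
∈-subsetOf⁺ P? {x} px = lookup⇒[]= x _ (trans (lookup∘tabulate (does ∘ P?) x) (dec-true (P? x) px))

∈-subsetOf⁻ : ∀ {k} {P : Fin k → Set} (P? : Decidable P) {x} → x ∈ subsetOf P? → P x
∈-subsetOf⁻ P? {x} x∈ with P? x | trans (sym (lookup∘tabulate (does ∘ P?) x)) ([]=⇒lookup x∈)
... | yes px | _  = px
... | no  _  | ()

∑-indicator : ∀ {k} (j : Fin k) → ∑[ i < k ] (if does (i ≟ j) then 1 else 0) ≡ 1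
∑-indicator {suc k} zero    = cong suc (sum-replicate-zero k)
∑-indicator {suc k} (suc j) = ∑-indicator j

sumᴸ-allFin : ∀ k (f : Fin k → ℕ) → sumᴸ (List.map f (allFin k)) ≡ ∑[ i < k ] f i
sumᴸ-allFin k f = trans (cong sumᴸ (List.map-tabulate id f)) (sumᴸ-tabulate k f)
  where
  sumᴸ-tabulate : ∀ k (f : Fin k → ℕ) → sumᴸ (List.tabulate f) ≡ ∑[ i < k ] f i
  sumᴸ-tabulate zero    f = refl
  sumᴸ-tabulate (suc k) f = cong (f zero +_) (sumᴸ-tabulate k (f ∘ suc))

-- Degrees and the handshake lemma

module _ (Γ : Graph) where
  open Graph Γ

  end₁ end₂ : Fin m → Fin n
  end₁ e = proj₁ (ends e)
  end₂ e = proj₂ (ends e)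

  ∑-mult≡2 : ∀ e → ∑[ v < n ] mult Γ v e ≡ 2
  ∑-mult≡2 e = trans (∑-distrib-+ (indicator (end₁ e)) (indicator (end₂ e)))
                     (cong₂ _+_ (∑-indicator (end₁ e)) (∑-indicator (end₂ e)))
    where
    indicator : Fin n → Fin n → ℕ
    indicator u v = if does (v ≟ u) then 1 else 0

  ∈ₑ⇒0<mult : ∀ {v e} → v ∈ₑ e → 0 < mult Γ v e
  ∈ₑ⇒0<mult {v} {e} (inj₁ refl) rewrite dec-true (v ≟ v) refl = s≤s z≤n
  ∈ₑ⇒0<mult {v} {e} (inj₂ refl) rewrite dec-true (v ≟ v) refl =
    subst (0 <_) (sym (+-suc _ 0)) (s≤s z≤n)

  0<mult⇒∈ₑ : ∀ {v e} → 0 < mult Γ v e → v ∈ₑ e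
  0<mult⇒∈ₑ {v} {e} 0<mult with v ≟ end₁ e | v ≟ end₂ e
  ... | yes v≡end₁ | _          = inj₁ v≡end₁
  ... | no  _      | yes v≡end₂ = inj₂ v≡end₂
  ... | no  _      | no  _      = contradiction 0<mult (λ ())

  deg≡sumOver : ∀ D v → deg Γ D v ≡ ∑[ e ∈ D ] mult Γ v e
  deg≡sumOver D v = sumᴸ-allFin m _

  handshake : ∀ D → ∑[ v < n ] deg Γ D v ≡ 2 * ∣ D ∣
  handshake D = begin
    ∑[ v < n ] deg Γ D v                 ≡⟨ sum-cong-≗ (deg≡sumOver D) ⟩
    ∑[ v < n ] ∑[ e < m ] term v e       ≡⟨ ∑-comm term ⟩
    ∑[ e < m ] ∑[ v < n ] term v e       ≡⟨ sum-cong-≗ edge-contribution ⟩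
    ∑[ _ ∈ D ] 2                         ≡⟨ sumOver-const D 2 ⟩
    2 * ∣ D ∣                            ∎
    where
    open ≡-Reasoning
    term : Fin n → Fin m → ℕ
    term v e = if does (e ∈? D) then mult Γ v e else 0
    edge-contribution : ∀ e → ∑[ v < n ] term v e ≡ (if does (e ∈? D) then 2 else 0)
    edge-contribution e with does (e ∈? D)
    ... | true  = ∑-mult≡2 e
    ... | false = sum-replicate-zero n

  deg-remove : ∀ {D e} v → e ∈ D → deg Γ D v ≡ mult Γ v e + deg Γ (D - e) v
  deg-remove {D} {e} v e∈D = begin
    deg Γ D v                              ≡⟨ deg≡sumOver D v ⟩
    ∑[ f ∈ D ] mult Γ v f                  ≡⟨ sumOver-remove (mult Γ v) e∈D ⟩
    mult Γ v e + ∑[ f ∈ D - e ] mult Γ v f ≡⟨ cong (mult Γ v e +_) (deg≡sumOver (D - e) v) ⟨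
    mult Γ v e + deg Γ (D - e) v           ∎
    where open ≡-Reasoning

  deg-mono-⊆ : ∀ {C D} v → C ⊆ D → deg Γ C v ≤ deg Γ D v
  deg-mono-⊆ {C} {D} v C⊆D = subst₂ _≤_ (sym (deg≡sumOver C v)) (sym (deg≡sumOver D v))
    (sumOver-mono-⊆ (mult Γ v) C⊆D)

  edge⇒0<deg : ∀ {D e v} → e ∈ D → v ∈ₑ e → 0 < deg Γ D v
  edge⇒0<deg {v = v} e∈D v∈e =
    subst (0 <_) (sym (deg-remove v e∈D)) (≤-trans (∈ₑ⇒0<mult v∈e) (m≤m+n _ _))

  edges⇒2≤deg : ∀ {D e f v} → e ∈ D → f ∈ D → e ≢ f → v ∈ₑ e → v ∈ₑ f → 2 ≤ deg Γ D v
  edges⇒2≤deg {v = v} e∈D f∈D e≢f v∈e v∈f = subst (2 ≤_) (sym (deg-remove v e∈D))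
    (+-mono-≤ (∈ₑ⇒0<mult v∈e) (edge⇒0<deg (x∈p∧x≢y⇒x∈p-y f∈D (e≢f ∘ sym)) v∈f))

  0<deg⇒edge : ∀ {D v} → 0 < deg Γ D v → ∃ λ e → e ∈ D × v ∈ₑ e
  0<deg⇒edge {D} {v} 0<deg with sumOver-pos D (mult Γ v) (subst (0 <_) (deg≡sumOver D v) 0<deg)
  ... | e , e∈D , 0<mult = e , e∈D , 0<mult⇒∈ₑ 0<mult

  EWalk-map : ∀ {F G : Fin m → Set} → (∀ {e} → F e → G e) → ∀ {u v} → EWalk Γ F u v → EWalk Γ G u v
  EWalk-map F⇒G here                     = here
  EWalk-map F⇒G (step e Fe u∈e w∈e walk) = step e (F⇒G Fe) u∈e w∈e (EWalk-map F⇒G walk)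

  GConnected-map : ∀ {W} {F G : Fin m → Set} → (∀ {e} → F e → G e) → GConnected Γ W F → GConnected Γ W G
  GConnected-map F⇒G (w , walk) = w , λ u v u∈W v∈W → EWalk-map F⇒G (walk u v u∈W v∈W)

  IsCycle-map : ∀ {F G : Fin m → Set} → (∀ {e} → F e → G e) → ∀ {C} → IsCycle Γ F C → IsCycle Γ G C
  IsCycle-map F⇒G (C⊆F , rest) = (λ e e∈C → F⇒G (C⊆F e e∈C)) , rest

  ProperIn : Subset n → Fin m → Set
  ProperIn W e = end₁ e ≢ end₂ e × end₁ e ∈ W × end₂ e ∈ W

  properIn? : ∀ W → Decidable (ProperIn W)
  properIn? W e = ¬? (end₁ e ≟ end₂ e) ×-dec end₁ e ∈? W ×-dec end₂ e ∈? W

  LooplessSubgraph : Subset n → Subset m → Set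
  LooplessSubgraph W D = ∀ {e} → e ∈ D → ProperIn W e

  end∈W : ∀ {W D e v} → LooplessSubgraph W D → e ∈ D → v ∈ₑ e → v ∈ W
  end∈W links e∈D (inj₁ refl) = proj₁ (proj₂ (links e∈D))
  end∈W links e∈D (inj₂ refl) = proj₂ (proj₂ (links e∈D))

  improper⇒single-vertex : ∀ {W e a b} → ¬ ProperIn W e → a ∈ₑ e → b ∈ₑ e → a ∈ W → b ∈ W → a ≡ b
  improper⇒single-vertex         _        (inj₁ refl) (inj₁ refl) _   _   = refl
  improper⇒single-vertex         _        (inj₂ refl) (inj₂ refl) _   _   = refl
  improper⇒single-vertex {e = e} improper (inj₁ refl) (inj₂ refl) a∈W b∈W with end₁ e ≟ end₂ e
  ... | yes a≡b = a≡b
  ... | no  a≢b = contradiction (a≢b , a∈W , b∈W) improper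
  improper⇒single-vertex improper (inj₂ refl) (inj₁ refl) a∈W b∈W =
    sym (improper⇒single-vertex improper (inj₁ refl) (inj₂ refl) b∈W a∈W)

  LooplessSubgraph⇒IsSubgraph : ∀ {W D} {F : Fin m → Set} → LooplessSubgraph W D → (∀ {e} → F e → e ∈ D) →
                                IsSubgraph Γ W F
  LooplessSubgraph⇒IsSubgraph links F⇒D e Fe v v∈e = end∈W links (F⇒D Fe) v∈e

  LooplessSubgraph⇒Loopless : ∀ {W D} {F : Fin m → Set} → LooplessSubgraph W D → (∀ {e} → F e → e ∈ D) →
                              Loopless Γ F
  LooplessSubgraph⇒Loopless links F⇒D e Fe = proj₁ (links (F⇒D Fe))

  other-end : ∀ {e v} → end₁ e ≢ end₂ e → v ∈ₑ e →
              ∃ λ x → x ∈ₑ e × x ≢ v × (∀ {a} → a ∈ₑ e → a ≢ v → a ≡ x)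
  other-end e-not-loop (inj₁ refl) =
    _ , inj₂ refl , e-not-loop ∘ sym ,
    λ { (inj₁ refl) a≢v → contradiction refl a≢v ; (inj₂ refl) _ → refl }
  other-end e-not-loop (inj₂ refl) =
    _ , inj₁ refl , e-not-loop ,
    λ { (inj₁ refl) _ → refl ; (inj₂ refl) a≢v → contradiction refl a≢v }

  UniqueCycle : (Fin m → Set) → Set
  UniqueCycle F = Σ[ C ∈ Subset m ] (IsCycle Γ F C × (∀ C' → IsCycle Γ F C' → C' ≡ C))

  cycle-vertex⇒2≤deg : ∀ {D C v} → IsCycle Γ (_∈ D) C → VtxOf Γ C v → 2 ≤ deg Γ D v
  cycle-vertex⇒2≤deg {v = v} (C⊆D , _ , deg≡2 , _) v∈C =
    subst (_≤ _) (deg≡2 v v∈C) (deg-mono-⊆ v (λ {e} → C⊆D e))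

  -- Deleting a vertex of degree one

  OnlyEdgeAt : Subset m → Fin n → Fin m → Set
  OnlyEdgeAt D v e = ∀ {f} → f ∈ D → v ∈ₑ f → f ≡ e

  deg≡1⇒OnlyEdgeAt : ∀ {D v e} → deg Γ D v ≡ 1 → e ∈ D → v ∈ₑ e → OnlyEdgeAt D v e
  deg≡1⇒OnlyEdgeAt {e = e} deg≡1 e∈D v∈e {f} f∈D v∈f with f ≟ e
  ... | yes f≡e = f≡e
  ... | no  f≢e = contradiction (subst (2 ≤_) deg≡1 (edges⇒2≤deg f∈D e∈D f≢e v∈f v∈e)) λ { (s≤s ()) }

  OnlyEdgeAt⇒∉ : ∀ {D v e f a} → OnlyEdgeAt D v e → f ∈ D - e → a ∈ₑ f → a ≢ v
  OnlyEdgeAt⇒∉ only-e f∈D-e a∈f refl = x∈p-y⇒x≢y f∈D-e (only-e (p─q⊆p _ _ f∈D-e) a∈f)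

  -- Collapse v onto x: only e touches v, and both ends of e go to x.
  reroute : ∀ {D v e x} → OnlyEdgeAt D v e → (∀ {a} → a ∈ₑ e → a ≢ v → a ≡ x) →
            ∀ {a b} → a ≢ v → b ≢ v → EWalk Γ (_∈ D) a b → EWalk Γ (_∈ D - e) a b
  reroute {D} {v} {e} {x} only-e x-other a≢v b≢v walk =
    subst₂ (EWalk Γ _) (collapse-fixed a≢v) (collapse-fixed b≢v) (collapse-walk walk)
    where
    collapse : Fin n → Fin n
    collapse u = if does (u ≟ v) then x else u

    collapse-fixed : ∀ {u} → u ≢ v → collapse u ≡ u
    collapse-fixed {u} u≢v rewrite dec-false (u ≟ v) u≢v = refl

    collapse-e : ∀ {a} → a ∈ₑ e → collapse a ≡ x
    collapse-e {a} a∈e with a ≟ v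
    ... | yes _   = refl
    ... | no  a≢v = x-other a∈e a≢v

    collapse-walk : ∀ {a b} → EWalk Γ (_∈ D) a b → EWalk Γ (_∈ D - e) (collapse a) (collapse b)
    collapse-walk here = here
    collapse-walk (step f f∈D a∈f c∈f rest) with f ≟ e
    ... | yes refl = subst (λ z → EWalk Γ _ z _) (trans (collapse-e c∈f) (sym (collapse-e a∈f)))
                       (collapse-walk rest)
    ... | no  f≢e  = step f f∈D-e (fixed a∈f) (fixed c∈f) (collapse-walk rest)
      where
      f∈D-e = x∈p∧x≢y⇒x∈p-y f∈D f≢e
      fixed : ∀ {u} → u ∈ₑ f → collapse u ∈ₑ f
      fixed u∈f = subst (_∈ₑ f) (sym (collapse-fixed (OnlyEdgeAt⇒∉ only-e f∈D-e u∈f))) u∈f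

  record Pruning (W : Subset n) (D : Subset m) : Set where
    field
      leaf         : Fin n
      leaf-edge    : Fin m
      shrinks-W    : ∣ W ∣ ≡ suc ∣ W - leaf ∣
      shrinks-D    : ∣ D ∣ ≡ suc ∣ D - leaf-edge ∣
      links        : LooplessSubgraph (W - leaf) (D - leaf-edge)
      connected    : GConnected Γ (W - leaf) (_∈ D - leaf-edge)
      keeps-cycles : ∀ C → IsCycle Γ (_∈ D) C → IsCycle Γ (_∈ D - leaf-edge) C

    ∣W-leaf∣≤ : ∀ {k} → ∣ W ∣ ≤ suc k → ∣ W - leaf ∣ ≤ k
    ∣W-leaf∣≤ ∣W∣≤1+k = s≤s⁻¹ (subst (_≤ suc _) shrinks-W ∣W∣≤1+k)

  prune : ∀ {W D v} → LooplessSubgraph W D → GConnected Γ W (_∈ D) → v ∈ W → deg Γ D v ≡ 1 → Pruning W D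
  prune {W} {D} {v} links (_ , walk) v∈W deg≡1 with 0<deg⇒edge (subst (0 <_) (sym deg≡1) (s≤s z≤n))
  ... | e , e∈D , v∈e with other-end (proj₁ (links e∈D)) v∈e
  ... | x , x∈e , x≢v , x-other = record
    { leaf         = v
    ; leaf-edge    = e
    ; shrinks-W    = x∈p⇒∣p∣≡1+∣p-x∣ v∈W
    ; shrinks-D    = x∈p⇒∣p∣≡1+∣p-x∣ e∈D
    ; links        = links′
    ; connected    = (x , x∈W-v) , λ a b a∈W-v b∈W-v →
                       reroute only-e x-other (x∈p-y⇒x≢y a∈W-v) (x∈p-y⇒x≢y b∈W-v)
                         (walk a b (p─q⊆p W _ a∈W-v) (p─q⊆p W _ b∈W-v))
    ; keeps-cycles = λ C cycle → (λ f → off-cycle cycle) , proj₂ cycle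
    }
    where
    only-e = deg≡1⇒OnlyEdgeAt deg≡1 e∈D v∈e

    x∈W-v : x ∈ W - v
    x∈W-v = x∈p∧x≢y⇒x∈p-y (end∈W links e∈D x∈e) x≢v

    links′ : LooplessSubgraph (W - v) (D - e)
    links′ {f} f∈D-e = proj₁ (links f∈D) , end∈W-v (inj₁ refl) , end∈W-v (inj₂ refl)
      where
      f∈D = p─q⊆p D _ f∈D-e
      end∈W-v : ∀ {a} → a ∈ₑ f → a ∈ W - v
      end∈W-v a∈f = x∈p∧x≢y⇒x∈p-y (end∈W links f∈D a∈f) (OnlyEdgeAt⇒∉ only-e f∈D-e a∈f)

    off-cycle : ∀ {C} → IsCycle Γ (_∈ D) C → ∀ {f} → f ∈ C → f ∈ D - e
    off-cycle cycle@(C⊆D , _) {f} f∈C = x∈p∧x≢y⇒x∈p-y (C⊆D f f∈C) λ { refl →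
      contradiction (subst (2 ≤_) deg≡1 (cycle-vertex⇒2≤deg cycle (f , f∈C , v∈e))) λ { (s≤s ()) } }

  connected⇒0<deg : ∀ {W D v} → GConnected Γ W (_∈ D) → 2 ≤ ∣ W ∣ → v ∈ W → 0 < deg Γ D v
  connected⇒0<deg {W} {D} {v} (_ , walk) 2≤∣W∣ v∈W
    with 0<∣p∣⇒Nonempty (W - v) (s≤s⁻¹ (subst (2 ≤_) (x∈p⇒∣p∣≡1+∣p-x∣ v∈W) 2≤∣W∣))
  ... | u , u∈W-v = first-edge (walk v u v∈W (p─q⊆p W _ u∈W-v)) (x∈p-y⇒x≢y u∈W-v)
    where
    first-edge : ∀ {u} → EWalk Γ (_∈ D) v u → u ≢ v → 0 < deg Γ D v
    first-edge here                    u≢v = contradiction refl u≢v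
    first-edge (step e e∈D v∈e _ _) _   = edge⇒0<deg e∈D v∈e

  ∑deg≤2*∣D∣ : ∀ W D → ∑[ v ∈ W ] deg Γ D v ≤ 2 * ∣ D ∣
  ∑deg≤2*∣D∣ W D = subst (∑[ v ∈ W ] deg Γ D v ≤_) (handshake D) (sumOver-≤-∑ W (deg Γ D))

  MinDegree2 : Subset n → Subset m → Set
  MinDegree2 W D = ∀ {v} → v ∈ W → 2 ≤ deg Γ D v

  minDegree2⇒∣W∣≤∣D∣ : ∀ {W D} → MinDegree2 W D → ∣ W ∣ ≤ ∣ D ∣
  minDegree2⇒∣W∣≤∣D∣ {W} {D} minDeg = *-cancelˡ-≤ 2 (begin
    2 * ∣ W ∣             ≡⟨ sumOver-const W 2 ⟨
    ∑[ _ ∈ W ] 2          ≤⟨ sumOver-monoʳ-≤ W minDeg ⟩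
    ∑[ v ∈ W ] deg Γ D v  ≤⟨ ∑deg≤2*∣D∣ W D ⟩
    2 * ∣ D ∣             ∎)
    where open ≤-Reasoning

  minDegree2⇒2-regular : ∀ {W D} → MinDegree2 W D → ∣ D ∣ ≡ ∣ W ∣ → ∀ {v} → v ∈ W → deg Γ D v ≡ 2
  minDegree2⇒2-regular {W} {D} minDeg ∣D∣≡∣W∣ {v} v∈W with deg Γ D v ≟ℕ 2
  ... | yes deg≡2 = deg≡2
  ... | no  deg≢2 = contradiction (begin-strict
    2 * ∣ W ∣             ≡⟨ sumOver-const W 2 ⟨
    ∑[ _ ∈ W ] 2          <⟨ sumOver-monoʳ-< W minDeg v∈W (≤∧≢⇒< (minDeg v∈W) (deg≢2 ∘ sym)) ⟩
    ∑[ u ∈ W ] deg Γ D u  ≤⟨ ∑deg≤2*∣D∣ W D ⟩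
    2 * ∣ D ∣             ≡⟨ cong (2 *_) ∣D∣≡∣W∣ ⟩
    2 * ∣ W ∣             ∎) (<-irrefl refl)
    where open ≤-Reasoning

  prune-or-minDegree2 : ∀ {W D} → LooplessSubgraph W D → GConnected Γ W (_∈ D) → 2 ≤ ∣ W ∣ →
                        Pruning W D ⊎ MinDegree2 W D
  prune-or-minDegree2 {W} {D} links conn 2≤∣W∣ with any? (λ v → v ∈? W ×-dec deg Γ D v <? 2)
  ... | yes (v , v∈W , deg<2) =
    inj₁ (prune links conn v∈W (≤-antisym (s≤s⁻¹ deg<2) (connected⇒0<deg conn 2≤∣W∣ v∈W)))
  ... | no  none = inj₂ (λ v∈W → ≮⇒≥ (λ deg<2 → none (_ , v∈W , deg<2)))

  prune-sparse : ∀ {W D} → LooplessSubgraph W D → GConnected Γ W (_∈ D) → ∣ D ∣ < ∣ W ∣ → 2 ≤ ∣ W ∣ →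
                 Pruning W D
  prune-sparse links conn ∣D∣<∣W∣ 2≤∣W∣ with prune-or-minDegree2 links conn 2≤∣W∣
  ... | inj₁ pruning = pruning
  ... | inj₂ minDeg  = contradiction (minDegree2⇒∣W∣≤∣D∣ minDeg) (<⇒≱ ∣D∣<∣W∣)

  nonempty⇒2≤∣W∣ : ∀ {W D} → LooplessSubgraph W D → Nonempty D → 2 ≤ ∣ W ∣
  nonempty⇒2≤∣W∣ links (e , e∈D) with links e∈D
  ... | not-loop , end₁∈W , end₂∈W = x,y∈p⇒2≤∣p∣ end₁∈W end₂∈W not-loop

  vertex∈W : ∀ {W D C v} → LooplessSubgraph W D → (∀ e → e ∈ C → e ∈ D) → VtxOf Γ C v → v ∈ W
  vertex∈W links C⊆D (e , e∈C , v∈e) = end∈W links (C⊆D e e∈C) v∈e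

  2-regular⇒unique-cycle : ∀ {W D} → LooplessSubgraph W D → GConnected Γ W (_∈ D) → Nonempty D →
                           (∀ {v} → v ∈ W → deg Γ D v ≡ 2) → UniqueCycle (_∈ D)
  2-regular⇒unique-cycle {W} {D} links (_ , walk) D≢∅ 2-regular = D , D-cycle , only-cycle
    where
    in-W : ∀ {v} → VtxOf Γ D v → v ∈ W
    in-W = vertex∈W links (λ _ e∈D → e∈D)

    D-cycle : IsCycle Γ (_∈ D) D
    D-cycle = (λ _ e∈D → e∈D) , D≢∅ , (λ v v∈D → 2-regular (in-W v∈D)) ,
              (λ u v u∈D v∈D → walk u v (in-W u∈D) (in-W v∈D))

    only-cycle : ∀ C → IsCycle Γ (_∈ D) C → C ≡ D
    only-cycle C (C⊆D , (e , e∈C) , deg≡2 , _) = ⊆-antisym (λ {f} → C⊆D f) D⊆C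
      where
      absorbs : ∀ {y g} → VtxOf Γ C y → g ∈ D → y ∈ₑ g → g ∈ C
      absorbs {y} {g} y∈C g∈D y∈g with g ∈? C
      ... | yes g∈C = g∈C
      ... | no  g∉C = contradiction (begin
        3                             ≡⟨ cong suc (deg≡2 y y∈C) ⟨
        suc (deg Γ C y)               ≤⟨ +-mono-≤ (∈ₑ⇒0<mult y∈g) (deg-mono-⊆ y C⊆D-g) ⟩
        mult Γ y g + deg Γ (D - g) y  ≡⟨ deg-remove y g∈D ⟨
        deg Γ D y                     ≡⟨ 2-regular (vertex∈W links C⊆D y∈C) ⟩
        2                             ∎) λ { (s≤s (s≤s ())) }
        where
        open ≤-Reasoning
        C⊆D-g : C ⊆ D - g
        C⊆D-g {f} f∈C = x∈p∧x≢y⇒x∈p-y (C⊆D f f∈C) λ { refl → g∉C f∈C }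

      spreads : ∀ {a b} → EWalk Γ (_∈ D) a b → VtxOf Γ C a → VtxOf Γ C b
      spreads here                       a∈C = a∈C
      spreads (step g g∈D a∈g b∈g rest)  a∈C = spreads rest (g , absorbs a∈C g∈D a∈g , b∈g)

      D⊆C : D ⊆ C
      D⊆C {g} g∈D = absorbs (spreads (walk _ _ (in-W e-start) (in-W g-start)) (e , e∈C , inj₁ refl))
                            g∈D (inj₁ refl)
        where
        e-start = (e , C⊆D e e∈C , inj₁ refl)
        g-start = (g , g∈D , inj₁ refl)

  -- Edge counts of connected loopless graphs

  connected⇒∣W∣≤1+∣D∣ : ∀ {W D} → LooplessSubgraph W D → GConnected Γ W (_∈ D) → ∣ W ∣ ≤ suc ∣ D ∣
  connected⇒∣W∣≤1+∣D∣ links conn = go _ ≤-refl links conn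
    where
    go : ∀ k {W D} → ∣ W ∣ ≤ k → LooplessSubgraph W D → GConnected Γ W (_∈ D) → ∣ W ∣ ≤ suc ∣ D ∣
    go zero    ∣W∣≤0 _ _ = ≤-trans ∣W∣≤0 z≤n
    go (suc k) {W} {D} ∣W∣≤1+k links conn with ∣ W ∣ ≤? suc ∣ D ∣
    ... | yes ∣W∣≤1+∣D∣ = ∣W∣≤1+∣D∣
    ... | no  ∣W∣≰1+∣D∣ = subst₂ _≤_ (sym shrinks-W) (cong suc (sym shrinks-D))
                            (s≤s (go k (∣W-leaf∣≤ ∣W∣≤1+k) links′ connected))
      where
      2+∣D∣≤∣W∣ = ≰⇒> ∣W∣≰1+∣D∣
      open Pruning (prune-sparse links conn (≤-trans (n≤1+n _) 2+∣D∣≤∣W∣)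
                                            (≤-trans (s≤s (s≤s z≤n)) 2+∣D∣≤∣W∣))
        renaming (links to links′)

  tree⇒acyclic : ∀ {W D} → LooplessSubgraph W D → GConnected Γ W (_∈ D) → suc ∣ D ∣ ≡ ∣ W ∣ →
                 ∀ C → ¬ IsCycle Γ (_∈ D) C
  tree⇒acyclic links conn = go _ ≤-refl links conn
    where
    go : ∀ k {W D} → ∣ W ∣ ≤ k → LooplessSubgraph W D → GConnected Γ W (_∈ D) → suc ∣ D ∣ ≡ ∣ W ∣ →
         ∀ C → ¬ IsCycle Γ (_∈ D) C
    go zero ∣W∣≤0 _ _ 1+∣D∣≡∣W∣ _ _ = contradiction (subst (_≤ 0) (sym 1+∣D∣≡∣W∣) ∣W∣≤0) λ ()
    go (suc k) {W} {D} ∣W∣≤1+k links conn 1+∣D∣≡∣W∣ C cycle@(C⊆D , (e , e∈C) , _) =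
      go k (∣W-leaf∣≤ ∣W∣≤1+k) links′ connected
        (suc-injective (trans (cong suc (sym shrinks-D)) (trans 1+∣D∣≡∣W∣ shrinks-W)))
        C (keeps-cycles C cycle)
      where
      ∣D∣<∣W∣ = subst (∣ D ∣ <_) 1+∣D∣≡∣W∣ ≤-refl
      2≤∣W∣   = subst (2 ≤_) 1+∣D∣≡∣W∣ (s≤s (x∈p⇒0<∣p∣ (C⊆D e e∈C)))
      open Pruning (prune-sparse links conn ∣D∣<∣W∣ 2≤∣W∣) renaming (links to links′)

  balanced⇒unique-cycle : ∀ {W D} → LooplessSubgraph W D → GConnected Γ W (_∈ D) → ∣ D ∣ ≡ ∣ W ∣ →
                          UniqueCycle (_∈ D)
  balanced⇒unique-cycle links conn = go _ ≤-refl links conn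
    where
    go : ∀ k {W D} → ∣ W ∣ ≤ k → LooplessSubgraph W D → GConnected Γ W (_∈ D) → ∣ D ∣ ≡ ∣ W ∣ →
         UniqueCycle (_∈ D)
    go zero ∣W∣≤0 _ ((_ , w∈W) , _) _ = contradiction (≤-trans (x∈p⇒0<∣p∣ w∈W) ∣W∣≤0) λ ()
    go (suc k) {W} {D} ∣W∣≤1+k links conn@((_ , w∈W) , _) ∣D∣≡∣W∣ =
      by-cases (prune-or-minDegree2 links conn (nonempty⇒2≤∣W∣ links D≢∅))
      where
      D≢∅ = 0<∣p∣⇒Nonempty D (subst (0 <_) (sym ∣D∣≡∣W∣) (x∈p⇒0<∣p∣ w∈W))

      by-cases : Pruning W D ⊎ MinDegree2 W D → UniqueCycle (_∈ D)
      by-cases (inj₂ minDeg)  =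
        2-regular⇒unique-cycle links conn D≢∅ (minDegree2⇒2-regular minDeg ∣D∣≡∣W∣)
      by-cases (inj₁ pruning) =
        C , IsCycle-map (p─q⊆p D _) C-cycle , λ C′ C′-cycle → C-unique C′ (keeps-cycles C′ C′-cycle)
        where
        open Pruning pruning renaming (links to links′)
        IH = go k (∣W-leaf∣≤ ∣W∣≤1+k) links′ connected
               (suc-injective (trans (sym shrinks-D) (trans ∣D∣≡∣W∣ shrinks-W)))
        C        = proj₁ IH
        C-cycle  = proj₁ (proj₂ IH)
        C-unique = proj₂ (proj₂ IH)

-- The induced hypergraph H[V' | E']

module _ (Γ : Graph) (V' : Subset (Graph.n Γ)) (E' : Subset (Graph.m Γ)) where
  open Graph Γ
  open Hypergraph (Induced Γ V' E') using () renaming (Vtx to Vtx')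

  properEdge? : Decidable (λ e → e ∈ E' × ProperIn Γ V' e)
  properEdge? e = e ∈? E' ×-dec properIn? Γ V' e

  properEdges : Subset m
  properEdges = subsetOf properEdge?

  properEdges⊆E' : properEdges ⊆ E'
  properEdges⊆E' = proj₁ ∘ ∈-subsetOf⁻ properEdge?

  properEdges-loopless : LooplessSubgraph Γ V' properEdges
  properEdges-loopless = proj₂ ∘ ∈-subsetOf⁻ properEdge?

  ∈-properEdges : ∀ {e} → e ∈ E' → ProperIn Γ V' e → e ∈ properEdges
  ∈-properEdges e∈E' proper = ∈-subsetOf⁺ properEdge? (e∈E' , proper)

  Vtx'-≡ : ∀ {a b : Vtx'} → proj₁ a ≡ proj₁ b → a ≡ b
  Vtx'-≡ {a , a∈V'} {_ , b∈V'} refl = cong (a ,_) ([]=-irrelevant a∈V' b∈V')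

  loop⇒improper : ∀ {e} → IsLoop (Induced Γ V' E') e → ¬ ProperIn Γ V' (proj₁ e)
  loop⇒improper (v , _ , only-v) (not-loop , end₁∈V' , end₂∈V') =
    not-loop (trans (cong proj₁ (only-v (_ , end₁∈V') (inj₁ refl)))
                    (sym (cong proj₁ (only-v (_ , end₂∈V') (inj₂ refl)))))

  nonempty⇒support : ∀ e → ¬ IsEmptyEdge (Induced Γ V' E') e →
                     ∃ λ (v : Vtx') → proj₁ v ∈ₑ proj₁ e
  nonempty⇒support (e , _) nonempty with end₁ Γ e ∈? V' | end₂ Γ e ∈? V'
  ... | yes end₁∈V' | _           = (_ , end₁∈V') , inj₁ refl
  ... | no  _       | yes end₂∈V' = (_ , end₂∈V') , inj₂ refl
  ... | no  end₁∉V' | no  end₂∉V' = contradiction (λ { (_ , v∈V') (inj₁ refl) → end₁∉V' v∈V'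
                                                     ; (_ , v∈V') (inj₂ refl) → end₂∉V' v∈V' }) nonempty

  induced-walk : ∀ {a b} → HWalk (Induced Γ V' E') a b → EWalk Γ (_∈ properEdges) (proj₁ a) (proj₁ b)
  induced-walk here = here
  induced-walk {a , a∈V'} (step {w = c , c∈V'} (e , e∈E') a∈e c∈e rest) with properIn? Γ V' e
  ... | yes proper   = step e (∈-properEdges e∈E' proper) a∈e c∈e (induced-walk rest)
  ... | no  improper =
    subst (λ x → EWalk Γ _ x _) (sym (improper⇒single-vertex Γ improper a∈e c∈e a∈V' c∈V'))
      (induced-walk rest)

  U1⇒proper : U1 Γ V' E' → ∀ {e} → e ∈ E' → ProperIn Γ V' e
  U1⇒proper (subgraph , loopless , _) {e} e∈E' =
    loopless e e∈E' , subgraph e e∈E' _ (inj₁ refl) , subgraph e e∈E' _ (inj₂ refl)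

  U1⇒¬U2 : U1 Γ V' E' → ¬ U2 Γ V' E'
  U1⇒¬U2 u1 ((e∘ , e∘∈E') , loop , _) = loop⇒improper {e∘ , e∘∈E'} loop (U1⇒proper u1 e∘∈E')

  module _ (∣V'∣≡∣E'∣ : ∣ V' ∣ ≡ ∣ E' ∣) (connected : HConnected (Induced Γ V' E')) where

    properEdges-connected : GConnected Γ V' (_∈ properEdges)
    properEdges-connected =
      (proj₁ v₀ , proj₂ v₀) , λ u w u∈V' w∈V' → induced-walk (walk (u , u∈V') (w , w∈V'))
      where
      v₀   = proj₁ connected
      walk = proj₂ (proj₂ connected)

    improper-edges-coincide : ∀ {e f} → e ∈ E' → f ∈ E' →
                              ¬ ProperIn Γ V' e → ¬ ProperIn Γ V' f → e ≡ f
    improper-edges-coincide {e} {f} e∈E' f∈E' e-improper f-improper with e ≟ f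
    ... | yes e≡f = e≡f
    ... | no  e≢f = contradiction (begin-strict
      ∣ E' ∣                    ≡⟨ ∣V'∣≡∣E'∣ ⟨
      ∣ V' ∣                    ≤⟨ connected⇒∣W∣≤1+∣D∣ Γ properEdges-loopless properEdges-connected ⟩
      suc ∣ properEdges ∣       ≤⟨ s≤s (p⊆q⇒∣p∣≤∣q∣ properEdges⊆E'-e-f) ⟩
      suc ∣ E' - e - f ∣        <⟨ n<1+n _ ⟩
      suc (suc ∣ E' - e - f ∣)  ≡⟨ cong suc (x∈p⇒∣p∣≡1+∣p-x∣ f∈E'-e) ⟨
      suc ∣ E' - e ∣            ≡⟨ x∈p⇒∣p∣≡1+∣p-x∣ e∈E' ⟨
      ∣ E' ∣                    ∎) (<-irrefl refl)
      where
      open ≤-Reasoning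
      f∈E'-e = x∈p∧x≢y⇒x∈p-y f∈E' (e≢f ∘ sym)
      properEdges⊆E'-e-f : properEdges ⊆ E' - e - f
      properEdges⊆E'-e-f g∈P = x∈p∧x≢y⇒x∈p-y (x∈p∧x≢y⇒x∈p-y (properEdges⊆E' g∈P) (≢-improper e-improper))
                                                                            (≢-improper f-improper)
        where
        ≢-improper : ∀ {h} → ¬ ProperIn Γ V' h → _ ≢ h
        ≢-improper h-improper refl = h-improper (properEdges-loopless g∈P)

    all-proper⇒U1 : (∀ {e} → e ∈ E' → ProperIn Γ V' e) → U1 Γ V' E'
    all-proper⇒U1 all-proper = subst (U1 Γ V') properEdges≡E' U1-properEdges
      where
      properEdges≡E' : properEdges ≡ E'
      properEdges≡E' = ⊆-antisym properEdges⊆E' (λ e∈E' → ∈-properEdges e∈E' (all-proper e∈E'))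
      U1-properEdges : U1 Γ V' properEdges
      U1-properEdges =
        LooplessSubgraph⇒IsSubgraph Γ properEdges-loopless (λ e∈P → e∈P) ,
        LooplessSubgraph⇒Loopless Γ properEdges-loopless (λ e∈P → e∈P) ,
        properEdges-connected ,
        balanced⇒unique-cycle Γ properEdges-loopless properEdges-connected
          (trans (cong ∣_∣ properEdges≡E') (sym ∣V'∣≡∣E'∣))

    module _ {e∘} (e∘∈E' : e∘ ∈ E') (e∘-improper : ¬ ProperIn Γ V' e∘) where

      Remaining : Fin m → Set
      Remaining e = e ∈ E' × e ≢ e∘

      Remaining⇒proper : ∀ {e} → Remaining e → e ∈ properEdges
      Remaining⇒proper {e} (e∈E' , e≢e∘) with properIn? Γ V' e
      ... | yes proper   = ∈-properEdges e∈E' proper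
      ... | no  improper = contradiction (improper-edges-coincide e∈E' e∘∈E' improper e∘-improper) e≢e∘

      proper⇒Remaining : ∀ {e} → e ∈ properEdges → Remaining e
      proper⇒Remaining e∈P = properEdges⊆E' e∈P , λ { refl → e∘-improper (properEdges-loopless e∈P) }

      properEdges≡E'-e∘ : properEdges ≡ E' - e∘
      properEdges≡E'-e∘ = ⊆-antisym
        (λ e∈P → x∈p∧x≢y⇒x∈p-y (proj₁ (proper⇒Remaining e∈P)) (proj₂ (proper⇒Remaining e∈P)))
        (λ e∈E'-e∘ → Remaining⇒proper (p─q⊆p E' _ e∈E'-e∘ , x∈p-y⇒x≢y e∈E'-e∘))

      1+∣properEdges∣≡∣V'∣ : suc ∣ properEdges ∣ ≡ ∣ V' ∣
      1+∣properEdges∣≡∣V'∣ = begin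
        suc ∣ properEdges ∣  ≡⟨ cong (suc ∘ ∣_∣) properEdges≡E'-e∘ ⟩
        suc ∣ E' - e∘ ∣      ≡⟨ x∈p⇒∣p∣≡1+∣p-x∣ e∘∈E' ⟨
        ∣ E' ∣               ≡⟨ ∣V'∣≡∣E'∣ ⟨
        ∣ V' ∣               ∎
        where open ≡-Reasoning

      e∘-loop : IsLoop (Induced Γ V' E') (e∘ , e∘∈E')
      e∘-loop with nonempty⇒support (e∘ , e∘∈E') (proj₁ (proj₂ connected) (e∘ , e∘∈E'))
      ... | v , v∈e∘ = v , v∈e∘ , λ w w∈e∘ →
        Vtx'-≡ (improper⇒single-vertex Γ e∘-improper w∈e∘ v∈e∘ (proj₂ w) (proj₂ v))

      only-loop : ∀ e → IsLoop (Induced Γ V' E') e → proj₁ e ≡ e∘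
      only-loop (e , e∈E') loop =
        improper-edges-coincide e∈E' e∘∈E' (loop⇒improper {e , e∈E'} loop) e∘-improper

      improper⇒U2 : U2 Γ V' E'
      improper⇒U2 =
        (e∘ , e∘∈E') , e∘-loop , only-loop ,
        LooplessSubgraph⇒IsSubgraph Γ properEdges-loopless Remaining⇒proper ,
        GConnected-map Γ proper⇒Remaining properEdges-connected ,
        λ C cycle → tree⇒acyclic Γ properEdges-loopless properEdges-connected 1+∣properEdges∣≡∣V'∣ C
                      (IsCycle-map Γ Remaining⇒proper cycle)

lemma5p6 : (Γ : Graph) (V' : Subset (Graph.n Γ)) (E' : Subset (Graph.m Γ)) →
    ∣ V' ∣ ≡ ∣ E' ∣ →
    HConnected (Induced Γ V' E') →
    Nondegenerate (Induced Γ V' E') →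
    ExactlyOne (U1 Γ V' E') (U2 Γ V' E')
lemma5p6 Γ V' E' ∣V'∣≡∣E'∣ connected _ with any? (λ e → e ∈? E' ×-dec ¬? (properIn? Γ V' e))
... | yes (e∘ , e∘∈E' , e∘-improper) = inj₂ (u2 , λ u1 → U1⇒¬U2 Γ V' E' u1 u2)
  where u2 = improper⇒U2 Γ V' E' ∣V'∣≡∣E'∣ connected e∘∈E' e∘-improper
... | no  no-improper = inj₁ (u1 , U1⇒¬U2 Γ V' E' u1)
  where u1 = all-proper⇒U1 Γ V' E' ∣V'∣≡∣E'∣ connected λ {e} e∈E' →
               decidable-stable (properIn? Γ V' e) (λ improper → no-improper (e , e∈E' , improper))
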